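{- Let $n,r,s$ be non-negative integers, $p$ a prime number, and $f\in\mathbb{Z}[u]$ a polynomial with integer coefficients. Then $$\sum_{k=0}^{p-1}f(k)\,(x+1)^{p-1-k}x^k\equiv f(\mathbf{F}_{\mathbf{x}})\pmod{p\mathbb{Z}_p[x]}.$$ In particular (taking $f(u)=(u+r-s)^n(u)_s$, respectively $f(u)=(u+r)^n(u+s)_s$), $$\sum_{k=0}^{p-1}(r-s+k)^n(k)_s(x+1)^{p-1-k}x^k\equiv x^s\mathcal{F}_n(x;r,s),$$ $$\sum_{k=0}^{p-1}(r+k)^n(s+k)_s(x+1)^{p-1-k}x^k\equiv (x+1)^s\mathcal{F}_n(x;r,s),$$ both modulo $p\mathbb{Z}_p[x]$.
   Context: $(\alpha)_j=\alpha(\alpha-1)\cdots(\alpha-j+1)$ for $j\ge1$, $(\alpha)_0=1$; convention $0^0=1$. ${n\brace k}$ denotes the Stirling numbers of the second kind, $\mathcal{F}_n(x)=\sum_{k=0}^n {n\brace k}k!\,x^k$ the Fubini polynomials. ${n\brace k}_r$ is the $r$-Stirling number of the second kind (partitions of $\{1,\dots,n\}$ into $k$ nonempty blocks with $1,\dots,r$ in distinct blocks), and $\mathcal{F}_n(x;r,s)=\sum_{k=0}^n {n+r\brace k+r}_r (k+s)!\,x^k$. Umbral notation: for $h(u)=\sum_k c_ku^k$, $h(\mathbf{F}_{\mathbf{x}}):=\sum_k c_k\mathcal{F}_k(x)$. $A\equiv B\pmod{p\mathbb{Z}_p[x]}$ means corresponding coefficients of $A,B$ are congruent modulo $p$ ($\mathbb{Z}_p$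 the $p$-adic integers). -}

module Defs where

open import Data.Nat as ℕ using (ℕ; zero; suc; _∸_; _!)
open import Data.Integer as ℤ using (ℤ; +_; _+_; _*_; _-_)
open import Data.Integer.Divisibility using (_∣_)
open import Data.List using (List; []; _∷_; map)

-- Polynomials with integer coefficients: coefficient lists, constant term first.
Poly : Set
Poly = List ℤ

coeff : Poly → ℕ → ℤ
coeff []       _       = + 0
coeff (a ∷ _)  zero    = a
coeff (_ ∷ as) (suc i) = coeff as i

infixl 6 _⊕_
infixl 7 _⊗_

_⊕_ : Poly → Poly → Poly
[]      ⊕ q       = q
(a ∷ p) ⊕ []      = a ∷ p
(a ∷ p) ⊕ (b ∷ q) = (a + b) ∷ (p ⊕ q)

scale : ℤ → Poly → Poly
scale c = map (c *_)

_⊗_ : Poly → Poly → Poly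
[]      ⊗ q = []
(a ∷ p) ⊗ q = scale a q ⊕ (+ 0 ∷ (p ⊗ q))

const : ℤ → Poly
const c = c ∷ []

X : Poly
X = + 0 ∷ + 1 ∷ []

_^ₚ_ : Poly → ℕ → Poly
p ^ₚ zero  = const (+ 1)
p ^ₚ suc n = p ⊗ (p ^ₚ n)

∑ₚ : ℕ → (ℕ → Poly) → Poly
∑ₚ zero    g = []
∑ₚ (suc n) g = ∑ₚ n g ⊕ g n

eval : Poly → ℤ → ℤ
eval []       a = + 0
eval (c ∷ cs) a = c + a * eval cs a

fall : ℤ → ℕ → ℤ
fall α zero    = + 1
fall α (suc j) = fall α j * (α - + j)

S2 : ℕ → ℕ → ℕ
S2 zero    zero    = 1
S2 zero    (suc k) = 0
S2 (suc n) zero    = 0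
S2 (suc n) (suc k) = suc k ℕ.* S2 n (suc k) ℕ.+ S2 n k

-- rS r n k = {n+r brace k+r}_r, r-Stirling numbers of the second kind,
-- via the standard recurrence {m brace j}_r = j {m-1 brace j}_r + {m-1 brace j-1}_r (m > r),
-- {r brace j}_r = δ_{j,r}, and {m brace j}_r = 0 for j < r.
rS : ℕ → ℕ → ℕ → ℕ
rS r zero    zero    = 1
rS r zero    (suc k) = 0
rS r (suc n) zero    = r ℕ.* rS r n zero
rS r (suc n) (suc k) = (suc k ℕ.+ r) ℕ.* rS r n (suc k) ℕ.+ rS r n k

fubini : ℕ → Poly
fubini n = ∑ₚ (suc n) (λ k → scale (+ (S2 n k ℕ.* k !)) (X ^ₚ k))

fubiniRS : ℕ → ℕ → ℕ → Poly
fubiniRS n r s = ∑ₚ (suc n) (λ k → scale (+ (rS r n k ℕ.* (k ℕ.+ s) !)) (X ^ₚ k))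

-- umbral evaluation f(F_x) = ∑_k c_k F_k(x) for f = ∑_k c_k u^k
umbralFrom : Poly → ℕ → Poly
umbralFrom []       i = []
umbralFrom (c ∷ cs) i = scale c (fubini i) ⊕ umbralFrom cs (suc i)

umbral : Poly → Poly
umbral f = umbralFrom f 0

-- A ≡ B (mod p ℤ_p[x]): all corresponding coefficients congruent mod p.
-- (For integer coefficients, divisibility by p in ℤ_p coincides with divisibility in ℤ.)
_≡ₚ_[mod_] : Poly → Poly → ℕ → Set
A ≡ₚ B [mod p ] = ∀ i → (+ p) ∣ (coeff A i - coeff B i)

wt : ℕ → ℕ → Poly
wt p k = ((X ⊕ const (+ 1)) ^ₚ (p ∸ 1 ∸ k)) ⊗ (X ^ₚ k)

module Submission where

-- Polynomials are handled through coefficient sequences ℕ → ℤ, on which x and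
-- 1 + x act as `shift` and `[1+x]^ 1`; Δ₀ i g denotes (Δ^i g)(0).  Each side is
-- compared with the sequence i ↦ Δ₀ i g for the relevant summand g.
--  * Left side: its coefficients L q g i satisfy the exact identity
--    L q (Δg) i = L q g (i+1) - g(0)·C(p, i+1) for i < q, and p ∣ C(p, i+1),
--    so induction on i gives L q g i ≡ Δ₀ i g (mod p) for i < p.
--  * Right sides: coeff f(F_x) i = Δ₀ i f exactly, since Δ₀ i (u^m) = {m brace i}·i!;
--    the r-Fubini sides agree with Δ₀ i of their summands because both obey the
--    same first-order recurrence in n (and translation by s gives the (x+1)^s form).
--  * In degrees ≥ p all coefficients of both sides are divisible by p.
-- `congruence-criterion` combines these; the theorem applies it three times.

open import Defs
open import Data.Nat using (ℕ)
open import Data.Nat.Primality using (Prime; prime; euclidsLemma)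
open import Data.Integer using (ℤ; +_; _+_; _-_; _*_; _^_)
open import Data.Product using (_×_; _,_)
open import Data.Nat as ℕ using (zero; suc; _∸_; _!; _≤_; _<_; z≤n; s≤s)
import Data.Integer.Properties as ℤP
import Data.Nat.Properties as ℕP
open import Data.Integer.Tactic.RingSolver using (solve-∀)
import Data.Nat.Tactic.RingSolver as ℕSolver
open import Data.List using ([]; _∷_)
open import Relation.Binary.PropositionalEquality
  using (_≡_; refl; sym; trans; cong; cong₂; subst; _≗_; module ≡-Reasoning)
open import Relation.Binary.Definitions using (tri<; tri≈; tri>)
open import Data.Sum using (inj₁; inj₂)
open import Data.Empty using (⊥-elim)
import Data.Nat.Divisibility as ℕD
open import Data.Integer.Divisibility.Signed
  using (_∣_; divides; ∣ᵤ⇒∣; ∣⇒∣ᵤ; ∣m∣n⇒∣m+n; ∣m∣n⇒∣m-n; ∣n⇒∣m*n)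

∣-zero : ∀ {d} → d ∣ + 0
∣-zero {d} = divides (+ 0) (sym (ℤP.*-zeroˡ d))

Seq : Set
Seq = ℕ → ℤ

shift : Seq → Seq
shift f zero    = + 0
shift f (suc i) = f i

shift^ : ℕ → Seq → Seq
shift^ zero    f = f
shift^ (suc k) f = shift (shift^ k f)

[1+x]^ : ℕ → Seq → Seq
[1+x]^ zero    f   = f
[1+x]^ (suc t) f i = [1+x]^ t f i + shift ([1+x]^ t f) i

δ₀ : Seq
δ₀ = coeff (const (+ 1))

shift-cong : ∀ {f g} → f ≗ g → shift f ≗ shift g
shift-cong e zero    = refl
shift-cong e (suc i) = e i

shift^-cong : ∀ k {f g} → f ≗ g → shift^ k f ≗ shift^ k g
shift^-cong zero    e = e
shift^-cong (suc k) e = shift-cong (shift^-cong k e)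

[1+x]^-cong : ∀ t {f g} → f ≗ g → [1+x]^ t f ≗ [1+x]^ t g
[1+x]^-cong zero    e   = e
[1+x]^-cong (suc t) e i = cong₂ _+_ ([1+x]^-cong t e i) (shift-cong ([1+x]^-cong t e) i)

shift^-+ : ∀ k f g → shift^ k (λ j → f j + g j) ≗ λ i → shift^ k f i + shift^ k g i
shift^-+ zero    f g i       = refl
shift^-+ (suc k) f g zero    = refl
shift^-+ (suc k) f g (suc i) = shift^-+ k f g i

shift^-* : ∀ k c f → shift^ k (λ j → c * f j) ≗ λ i → c * shift^ k f i
shift^-* zero    c f i       = refl
shift^-* (suc k) c f zero    = sym (ℤP.*-zeroʳ c)
shift^-* (suc k) c f (suc i) = shift^-* k c f i

shift^-shift : ∀ k f → shift^ k (shift f) ≗ shift (shift^ k f)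
shift^-shift zero    f i = refl
shift^-shift (suc k) f i = shift-cong (shift^-shift k f) i

shift^-below : ∀ k f i → i < k → shift^ k f i ≡ + 0
shift^-below (suc k) f zero    _         = refl
shift^-below (suc k) f (suc i) (s≤s i<k) = shift^-below k f i i<k

shift^-at : ∀ k f j → shift^ k f (k ℕ.+ j) ≡ f j
shift^-at zero    f j = refl
shift^-at (suc k) f j = shift^-at k f j

shift^-δ₀-at : ∀ k → shift^ k δ₀ k ≡ + 1
shift^-δ₀-at zero    = refl
shift^-δ₀-at (suc k) = shift^-δ₀-at k

shift^-δ₀-above : ∀ k i → k < i → shift^ k δ₀ i ≡ + 0
shift^-δ₀-above zero    (suc i) _         = refl
shift^-δ₀-above (suc k) (suc i) (s≤s k<i) = shift^-δ₀-above k i k<i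

[1+x]^-shift : ∀ t f → [1+x]^ t (shift f) ≗ shift ([1+x]^ t f)
[1+x]^-shift zero    f i       = refl
[1+x]^-shift (suc t) f zero    = cong (_+ + 0) ([1+x]^-shift t f zero)
[1+x]^-shift (suc t) f (suc i) = cong₂ _+_ ([1+x]^-shift t f (suc i)) ([1+x]^-shift t f i)

[1+x]^-shift^ : ∀ t k f → [1+x]^ t (shift^ k f) ≗ shift^ k ([1+x]^ t f)
[1+x]^-shift^ t zero    f i = refl
[1+x]^-shift^ t (suc k) f i =
  trans ([1+x]^-shift t (shift^ k f) i) (shift-cong ([1+x]^-shift^ t k f) i)

coeff-⊕ : ∀ A B i → coeff (A ⊕ B) i ≡ coeff A i + coeff B i
coeff-⊕ []      B       i       = sym (ℤP.+-identityˡ _)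
coeff-⊕ (a ∷ A) []      i       = sym (ℤP.+-identityʳ _)
coeff-⊕ (a ∷ A) (b ∷ B) zero    = refl
coeff-⊕ (a ∷ A) (b ∷ B) (suc i) = coeff-⊕ A B i

coeff-scale : ∀ c A i → coeff (scale c A) i ≡ c * coeff A i
coeff-scale c []      i       = sym (ℤP.*-zeroʳ c)
coeff-scale c (a ∷ A) zero    = refl
coeff-scale c (a ∷ A) (suc i) = coeff-scale c A i

coeff-0∷ : ∀ A → coeff (+ 0 ∷ A) ≗ shift (coeff A)
coeff-0∷ A zero    = refl
coeff-0∷ A (suc i) = refl

coeff-∷⊗ : ∀ a A B i → coeff ((a ∷ A) ⊗ B) i ≡ a * coeff B i + shift (coeff (A ⊗ B)) i
coeff-∷⊗ a A B i =
  trans (coeff-⊕ (scale a B) (+ 0 ∷ (A ⊗ B)) i)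
        (cong₂ _+_ (coeff-scale a B i) (coeff-0∷ (A ⊗ B) i))

coeff-0∷⊗ : ∀ A B → coeff ((+ 0 ∷ A) ⊗ B) ≗ shift (coeff (A ⊗ B))
coeff-0∷⊗ A B i = trans (coeff-∷⊗ (+ 0) A B i) (ℤP.+-identityˡ _)

coeff-1⊗ : ∀ B → coeff (const (+ 1) ⊗ B) ≗ coeff B
coeff-1⊗ B i = trans (coeff-∷⊗ (+ 1) [] B i)
  (trans (cong₂ _+_ (ℤP.*-identityˡ (coeff B i)) (shift-[] i)) (ℤP.+-identityʳ (coeff B i)))
  where
  shift-[] : ∀ i → shift (coeff []) i ≡ + 0
  shift-[] zero    = refl
  shift-[] (suc i) = refl

⊗-zeroˡ : ∀ A B → (∀ i → coeff A i ≡ + 0) → ∀ i → coeff (A ⊗ B) i ≡ + 0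
⊗-zeroˡ []      B e i = refl
⊗-zeroˡ (a ∷ A) B e i = begin
  coeff ((a ∷ A) ⊗ B) i                      ≡⟨ coeff-∷⊗ a A B i ⟩
  a * coeff B i + shift (coeff (A ⊗ B)) i    ≡⟨ cong₂ _+_ (cong (_* coeff B i) (e 0)) (shift-zero i) ⟩
  + 0 * coeff B i + + 0                      ≡⟨ cong (_+ + 0) (ℤP.*-zeroˡ (coeff B i)) ⟩
  + 0                                        ∎
  where
  open ≡-Reasoning
  shift-zero : ∀ i → shift (coeff (A ⊗ B)) i ≡ + 0
  shift-zero zero    = refl
  shift-zero (suc i) = ⊗-zeroˡ A B (λ j → e (suc j)) i

-- The coefficients of A ⊗ B depend only on the coefficients of A
-- (lists with trailing zeros represent the same polynomial).
⊗-congˡ : ∀ A A' B → coeff A ≗ coeff A' → coeff (A ⊗ B) ≗ coeff (A' ⊗ B)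
⊗-congˡ []      []        B e i = refl
⊗-congˡ []      (a' ∷ A') B e i = sym (⊗-zeroˡ (a' ∷ A') B (λ j → sym (e j)) i)
⊗-congˡ (a ∷ A) []        B e i = ⊗-zeroˡ (a ∷ A) B e i
⊗-congˡ (a ∷ A) (a' ∷ A') B e i = begin
  coeff ((a ∷ A) ⊗ B) i                     ≡⟨ coeff-∷⊗ a A B i ⟩
  a * coeff B i + shift (coeff (A ⊗ B)) i   ≡⟨ cong₂ _+_ (cong (_* coeff B i) (e 0))
                                                        (shift-cong (⊗-congˡ A A' B (λ j → e (suc j))) i) ⟩
  a' * coeff B i + shift (coeff (A' ⊗ B)) i ≡⟨ sym (coeff-∷⊗ a' A' B i) ⟩
  coeff ((a' ∷ A') ⊗ B) i                   ∎
  where open ≡-Reasoning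

⊗-distribʳ : ∀ A A' B i → coeff ((A ⊕ A') ⊗ B) i ≡ coeff (A ⊗ B) i + coeff (A' ⊗ B) i
⊗-distribʳ []      A'        B i = sym (ℤP.+-identityˡ _)
⊗-distribʳ (a ∷ A) []        B i = sym (ℤP.+-identityʳ _)
⊗-distribʳ (a ∷ A) (a' ∷ A') B i = begin
  coeff (((a + a') ∷ (A ⊕ A')) ⊗ B) i
    ≡⟨ coeff-∷⊗ (a + a') (A ⊕ A') B i ⟩
  (a + a') * b + shift (coeff ((A ⊕ A') ⊗ B)) i
    ≡⟨ cong (_+_ ((a + a') * b)) (shift-cong (⊗-distribʳ A A' B) i) ⟩
  (a + a') * b + shift (λ j → coeff (A ⊗ B) j + coeff (A' ⊗ B) j) i
    ≡⟨ cong (_+_ ((a + a') * b)) (shift^-+ 1 (coeff (A ⊗ B)) (coeff (A' ⊗ B)) i) ⟩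
  (a + a') * b + (shift (coeff (A ⊗ B)) i + shift (coeff (A' ⊗ B)) i)
    ≡⟨ regroup a a' b _ _ ⟩
  (a * b + shift (coeff (A ⊗ B)) i) + (a' * b + shift (coeff (A' ⊗ B)) i)
    ≡⟨ sym (cong₂ _+_ (coeff-∷⊗ a A B i) (coeff-∷⊗ a' A' B i)) ⟩
  coeff ((a ∷ A) ⊗ B) i + coeff ((a' ∷ A') ⊗ B) i ∎
  where
  open ≡-Reasoning
  b = coeff B i
  regroup : ∀ a a' c u v → (a + a') * c + (u + v) ≡ (a * c + u) + (a' * c + v)
  regroup = solve-∀

coeff-X⊗ : ∀ B → coeff (X ⊗ B) ≗ shift (coeff B)
coeff-X⊗ B i = trans (coeff-0∷⊗ (const (+ 1)) B i) (shift-cong (coeff-1⊗ B) i)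

coeff-X1⊗ : ∀ B → coeff ((X ⊕ const (+ 1)) ⊗ B) ≗ [1+x]^ 1 (coeff B)
coeff-X1⊗ B i = trans (coeff-∷⊗ (+ 1) (const (+ 1)) B i)
                      (cong₂ _+_ (ℤP.*-identityˡ (coeff B i)) (shift-cong (coeff-1⊗ B) i))

coeff-X^⊗ : ∀ s B → coeff ((X ^ₚ s) ⊗ B) ≗ shift^ s (coeff B)
coeff-X^⊗ zero    B = coeff-1⊗ B
coeff-X^⊗ (suc s) B i = begin
  coeff ((X ⊗ P) ⊗ B) i         ≡⟨ ⊗-congˡ (X ⊗ P) (+ 0 ∷ P) B X⊗P≈0∷P i ⟩
  coeff ((+ 0 ∷ P) ⊗ B) i       ≡⟨ coeff-0∷⊗ P B i ⟩
  shift (coeff (P ⊗ B)) i       ≡⟨ shift-cong (coeff-X^⊗ s B) i ⟩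
  shift^ (suc s) (coeff B) i    ∎
  where
  open ≡-Reasoning
  P = X ^ₚ s
  X⊗P≈0∷P : coeff (X ⊗ P) ≗ coeff (+ 0 ∷ P)
  X⊗P≈0∷P j = trans (coeff-X⊗ P j) (sym (coeff-0∷ P j))

coeff-X1^⊗ : ∀ t B → coeff (((X ⊕ const (+ 1)) ^ₚ t) ⊗ B) ≗ [1+x]^ t (coeff B)
coeff-X1^⊗ zero    B = coeff-1⊗ B
coeff-X1^⊗ (suc t) B i = begin
  coeff ((X1 ⊗ P) ⊗ B) i                    ≡⟨ ⊗-congˡ (X1 ⊗ P) (P ⊕ (+ 0 ∷ P)) B X1⊗P≈P+0∷P i ⟩
  coeff ((P ⊕ (+ 0 ∷ P)) ⊗ B) i             ≡⟨ ⊗-distribʳ P (+ 0 ∷ P) B i ⟩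
  coeff (P ⊗ B) i + coeff ((+ 0 ∷ P) ⊗ B) i ≡⟨ cong (_+_ (coeff (P ⊗ B) i)) (coeff-0∷⊗ P B i) ⟩
  coeff (P ⊗ B) i + shift (coeff (P ⊗ B)) i ≡⟨ [1+x]^-cong 1 (coeff-X1^⊗ t B) i ⟩
  [1+x]^ (suc t) (coeff B) i                ∎
  where
  open ≡-Reasoning
  X1 = X ⊕ const (+ 1)
  P  = X1 ^ₚ t
  X1⊗P≈P+0∷P : coeff (X1 ⊗ P) ≗ coeff (P ⊕ (+ 0 ∷ P))
  X1⊗P≈P+0∷P j = trans (coeff-X1⊗ P j)
    (sym (trans (coeff-⊕ P (+ 0 ∷ P) j) (cong (_+_ (coeff P j)) (coeff-0∷ P j))))

coeff-X^ : ∀ k → coeff (X ^ₚ k) ≗ shift^ k δ₀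
coeff-X^ zero    i = refl
coeff-X^ (suc k) i = trans (coeff-X⊗ (X ^ₚ k) i) (shift-cong (coeff-X^ k) i)

coeff-wt : ∀ q k → coeff (wt (suc q) k) ≗ shift^ k ([1+x]^ (q ∸ k) δ₀)
coeff-wt q k i = begin
  coeff (wt (suc q) k) i                ≡⟨ coeff-X1^⊗ (q ∸ k) (X ^ₚ k) i ⟩
  [1+x]^ (q ∸ k) (coeff (X ^ₚ k)) i     ≡⟨ [1+x]^-cong (q ∸ k) (coeff-X^ k) i ⟩
  [1+x]^ (q ∸ k) (shift^ k δ₀) i        ≡⟨ [1+x]^-shift^ (q ∸ k) k δ₀ i ⟩
  shift^ k ([1+x]^ (q ∸ k) δ₀) i        ∎
  where open ≡-Reasoning

Σ< : ℕ → Seq → ℤ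
Σ< zero    f = + 0
Σ< (suc n) f = Σ< n f + f n

Σ<-cong< : ∀ n {f g} → (∀ k → k < n → f k ≡ g k) → Σ< n f ≡ Σ< n g
Σ<-cong< zero    e = refl
Σ<-cong< (suc n) e = cong₂ _+_ (Σ<-cong< n (λ k k<n → e k (ℕP.m<n⇒m<1+n k<n))) (e n ℕP.≤-refl)

Σ<-cong : ∀ n {f g} → f ≗ g → Σ< n f ≡ Σ< n g
Σ<-cong n e = Σ<-cong< n (λ k _ → e k)

Σ<-zero : ∀ n {f} → (∀ k → k < n → f k ≡ + 0) → Σ< n f ≡ + 0
Σ<-zero zero    e = refl
Σ<-zero (suc n) e = cong₂ _+_ (Σ<-zero n (λ k k<n → e k (ℕP.m<n⇒m<1+n k<n))) (e n ℕP.≤-refl)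

Σ<-first : ∀ n f → Σ< (suc n) f ≡ f 0 + Σ< n (λ k → f (suc k))
Σ<-first zero    f = trans (ℤP.+-identityˡ (f 0)) (sym (ℤP.+-identityʳ (f 0)))
Σ<-first (suc n) f = trans (cong (_+ f (suc n)) (Σ<-first n f)) (ℤP.+-assoc (f 0) _ _)

Σ<-+ : ∀ n f g → Σ< n (λ k → f k + g k) ≡ Σ< n f + Σ< n g
Σ<-+ zero    f g = refl
Σ<-+ (suc n) f g = trans (cong (_+ (f n + g n)) (Σ<-+ n f g)) (swap (Σ< n f) (Σ< n g) (f n) (g n))
  where
  swap : ∀ a b c d → (a + b) + (c + d) ≡ (a + c) + (b + d)
  swap = solve-∀

Σ<-- : ∀ n f g → Σ< n (λ k → f k - g k) ≡ Σ< n f - Σ< n g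
Σ<-- zero    f g = refl
Σ<-- (suc n) f g = trans (cong (_+ (f n - g n)) (Σ<-- n f g)) (swap (Σ< n f) (Σ< n g) (f n) (g n))
  where
  swap : ∀ a b c d → (a - b) + (c - d) ≡ (a + c) - (b + d)
  swap = solve-∀

Σ<-shift : ∀ n (a : Seq) (h : ℕ → Seq) i →
  Σ< n (λ k → a k * shift (h k) i) ≡ shift (λ j → Σ< n (λ k → a k * h k j)) i
Σ<-shift n a h zero    = Σ<-zero n (λ k _ → ℤP.*-zeroʳ (a k))
Σ<-shift n a h (suc i) = refl

coeff-∑ₚ : ∀ n G i → coeff (∑ₚ n G) i ≡ Σ< n (λ k → coeff (G k) i)
coeff-∑ₚ zero    G i = refl
coeff-∑ₚ (suc n) G i = trans (coeff-⊕ (∑ₚ n G) (G n) i) (cong (_+ coeff (G n) i) (coeff-∑ₚ n G i))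

Σ<-unit-above : ∀ n (a : Seq) i → n ≤ i → Σ< n (λ k → a k * shift^ k δ₀ i) ≡ + 0
Σ<-unit-above n a i n≤i = Σ<-zero n (λ k k<n →
  trans (cong (a k *_) (shift^-δ₀-above k i (ℕP.<-≤-trans k<n n≤i))) (ℤP.*-zeroʳ (a k)))

Σ<-unit : ∀ n (a : Seq) i → (n ≤ i → a i ≡ + 0) → Σ< n (λ k → a k * shift^ k δ₀ i) ≡ a i
Σ<-unit zero    a i vanish = sym (vanish z≤n)
Σ<-unit (suc n) a i vanish with ℕP.<-cmp i n
... | tri< i<n _ _ = begin
  Σ< n (λ k → a k * shift^ k δ₀ i) + a n * shift^ n δ₀ i
    ≡⟨ cong₂ _+_ (Σ<-unit n a i (λ n≤i → ⊥-elim (ℕP.<⇒≱ i<n n≤i)))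
                 (cong (a n *_) (shift^-below n δ₀ i i<n)) ⟩
  a i + a n * + 0 ≡⟨ cong (_+_ (a i)) (ℤP.*-zeroʳ (a n)) ⟩
  a i + + 0       ≡⟨ ℤP.+-identityʳ (a i) ⟩
  a i             ∎
  where open ≡-Reasoning
... | tri≈ _ refl _ = begin
  Σ< n (λ k → a k * shift^ k δ₀ n) + a n * shift^ n δ₀ n
    ≡⟨ cong₂ _+_ (Σ<-unit-above n a n ℕP.≤-refl) (cong (a n *_) (shift^-δ₀-at n)) ⟩
  + 0 + a n * + 1 ≡⟨ ℤP.+-identityˡ (a n * + 1) ⟩
  a n * + 1       ≡⟨ ℤP.*-identityʳ (a n) ⟩
  a n             ∎
  where open ≡-Reasoning
... | tri> _ _ n<i = begin
  Σ< n (λ k → a k * shift^ k δ₀ i) + a n * shift^ n δ₀ i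
    ≡⟨ cong₂ _+_ (Σ<-unit-above n a i (ℕP.<⇒≤ n<i)) (cong (a n *_) (shift^-δ₀-above n i n<i)) ⟩
  + 0 + a n * + 0 ≡⟨ trans (ℤP.+-identityˡ (a n * + 0)) (ℤP.*-zeroʳ (a n)) ⟩
  + 0             ≡⟨ sym (vanish n<i) ⟩
  a i             ∎
  where open ≡-Reasoning

coeff-monomials : ∀ n (a : Seq) → (∀ i → n ≤ i → a i ≡ + 0) →
  coeff (∑ₚ n (λ k → scale (a k) (X ^ₚ k))) ≗ a
coeff-monomials n a vanish i = begin
  coeff (∑ₚ n (λ k → scale (a k) (X ^ₚ k))) i   ≡⟨ coeff-∑ₚ n _ i ⟩
  Σ< n (λ k → coeff (scale (a k) (X ^ₚ k)) i)    ≡⟨ Σ<-cong n (λ k → trans (coeff-scale (a k) (X ^ₚ k) i)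
                                                                          (cong (a k *_) (coeff-X^ k i))) ⟩
  Σ< n (λ k → a k * shift^ k δ₀ i)               ≡⟨ Σ<-unit n a i (vanish i) ⟩
  a i                                            ∎
  where open ≡-Reasoning

E : Seq → Seq
E g k = g (suc k)

Δ : Seq → Seq
Δ g k = g (suc k) - g k

Δ₀ : ℕ → Seq → ℤ
Δ₀ zero    g = g 0
Δ₀ (suc i) g = Δ₀ i (Δ g)

Δ₀-cong : ∀ i {g h} → g ≗ h → Δ₀ i g ≡ Δ₀ i h
Δ₀-cong zero    e = e 0
Δ₀-cong (suc i) e = Δ₀-cong i (λ k → cong₂ _-_ (e (suc k)) (e k))

Δ₀-zero : ∀ i {g} → (∀ k → g k ≡ + 0) → Δ₀ i g ≡ + 0
Δ₀-zero zero    e = e 0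
Δ₀-zero (suc i) e = Δ₀-zero i (λ k → cong₂ _-_ (e (suc k)) (e k))

Δ₀-+ : ∀ i g h → Δ₀ i (λ k → g k + h k) ≡ Δ₀ i g + Δ₀ i h
Δ₀-+ zero    g h = refl
Δ₀-+ (suc i) g h = trans (Δ₀-cong i (λ k → swap (g (suc k)) (h (suc k)) (g k) (h k))) (Δ₀-+ i (Δ g) (Δ h))
  where
  swap : ∀ a b c d → (a + b) - (c + d) ≡ (a - c) + (b - d)
  swap = solve-∀

Δ₀-- : ∀ i g h → Δ₀ i (λ k → g k - h k) ≡ Δ₀ i g - Δ₀ i h
Δ₀-- zero    g h = refl
Δ₀-- (suc i) g h = trans (Δ₀-cong i (λ k → swap (g (suc k)) (h (suc k)) (g k) (h k))) (Δ₀-- i (Δ g) (Δ h))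
  where
  swap : ∀ a b c d → (a - b) - (c - d) ≡ (a - c) - (b - d)
  swap = solve-∀

Δ₀-* : ∀ i c g → Δ₀ i (λ k → c * g k) ≡ c * Δ₀ i g
Δ₀-* zero    c g = refl
Δ₀-* (suc i) c g = trans (Δ₀-cong i (λ k → factor c (g (suc k)) (g k))) (Δ₀-* i c (Δ g))
  where
  factor : ∀ c a b → c * a - c * b ≡ c * (a - b)
  factor = solve-∀

Δ₀-E : ∀ i g → Δ₀ i (E g) ≡ Δ₀ i g + Δ₀ (suc i) g
Δ₀-E i g = begin
  Δ₀ i (E g)                          ≡⟨ add-sub (Δ₀ i (E g)) (Δ₀ i g) ⟩
  Δ₀ i g + (Δ₀ i (E g) - Δ₀ i g)      ≡⟨ cong (_+_ (Δ₀ i g)) (sym (Δ₀-- i (E g) g)) ⟩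
  Δ₀ i g + Δ₀ (suc i) g               ∎
  where
  open ≡-Reasoning
  add-sub : ∀ a b → a ≡ b + (a - b)
  add-sub = solve-∀

Δ₀-id* : ∀ i h → Δ₀ (suc i) (λ k → + k * h k) ≡ + suc i * Δ₀ i (E h)
Δ₀-id* zero    h = expand (h 1) (h 0)
  where
  expand : ∀ a b → + 1 * a - + 0 * b ≡ + 1 * a
  expand = solve-∀
Δ₀-id* (suc i) h = begin
  Δ₀ (suc i) (Δ (λ k → + k * h k))                 ≡⟨ Δ₀-cong (suc i) (λ k → expand (+ k) (h k) (h (suc k))) ⟩
  Δ₀ (suc i) (λ k → + k * Δ h k + E h k)           ≡⟨ Δ₀-+ (suc i) (λ k → + k * Δ h k) (E h) ⟩
  Δ₀ (suc i) (λ k → + k * Δ h k) + Δ₀ (suc i) (E h) ≡⟨ cong (_+ Δ₀ (suc i) (E h)) (Δ₀-id* i (Δ h)) ⟩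
  + suc i * Δ₀ (suc i) (E h) + Δ₀ (suc i) (E h)    ≡⟨ collect (+ suc i) _ ⟩
  + suc (suc i) * Δ₀ (suc i) (E h)                 ∎
  where
  open ≡-Reasoning
  expand : ∀ a x y → (+ 1 + a) * y - a * x ≡ a * (y - x) + y
  expand = solve-∀
  collect : ∀ a z → a * z + z ≡ (+ 1 + a) * z
  collect = solve-∀

-- The product rule in a form valid for every i (including i = 0).
Δ₀-id*′ : ∀ i h → Δ₀ i (λ k → + k * h k) ≡ + i * (shift (λ j → Δ₀ j h) i + Δ₀ i h)
Δ₀-id*′ zero    h = trans (ℤP.*-zeroˡ (h 0)) (sym (ℤP.*-zeroˡ (+ 0 + h 0)))
Δ₀-id*′ (suc i) h = trans (Δ₀-id* i h) (cong (+ suc i *_) (Δ₀-E i h))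

Δ₀-pow : ∀ m i → Δ₀ i (λ k → (+ k) ^ m) ≡ + (S2 m i ℕ.* i !)
Δ₀-pow zero    zero    = refl
Δ₀-pow zero    (suc i) = Δ₀-zero i (λ k → refl)
Δ₀-pow (suc m) zero    = ℤP.*-zeroˡ ((+ 0) ^ m)
Δ₀-pow (suc m) (suc i) = begin
  Δ₀ (suc i) (λ k → + k * (+ k) ^ m)
    ≡⟨ Δ₀-id* i (λ k → (+ k) ^ m) ⟩
  + suc i * Δ₀ i (λ k → (+ suc k) ^ m)
    ≡⟨ cong (+ suc i *_) (Δ₀-E i (λ k → (+ k) ^ m)) ⟩
  + suc i * (Δ₀ i (λ k → (+ k) ^ m) + Δ₀ (suc i) (λ k → (+ k) ^ m))
    ≡⟨ cong₂ (λ u v → + suc i * (u + v)) (Δ₀-pow m i) (Δ₀-pow m (suc i)) ⟩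
  + suc i * + (S2 m i ℕ.* i ! ℕ.+ S2 m (suc i) ℕ.* (suc i) !)
    ≡⟨ sym (ℤP.pos-* (suc i) _) ⟩
  + (suc i ℕ.* (S2 m i ℕ.* i ! ℕ.+ S2 m (suc i) ℕ.* (suc i) !))
    ≡⟨ cong +_ (stirling-step i (S2 m i) (S2 m (suc i)) (i !)) ⟩
  + (S2 (suc m) (suc i) ℕ.* (suc i) !) ∎
  where
  open ≡-Reasoning
  stirling-step : ∀ i a b f → suc i ℕ.* (a ℕ.* f ℕ.+ b ℕ.* (f ℕ.+ i ℕ.* f))
                            ≡ (suc i ℕ.* b ℕ.+ a) ℕ.* (f ℕ.+ i ℕ.* f)
  stirling-step = ℕSolver.solve-∀

factorialUnit : ℕ → Seq
factorialUnit s zero    = + (s !)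
factorialUnit s (suc j) = + 0

Δ-fall : ∀ s k → fall (+ suc k) (suc s) - fall (+ k) (suc s) ≡ + suc s * fall (+ k) s
Δ-fall s k = trans (cong (_- fall (+ k) (suc s)) (fall-succ (+ k) s)) (collect (+ k) (fall (+ k) s) (+ s))
  where
  fall-succ : ∀ α j → fall (+ 1 + α) (suc j) ≡ (+ 1 + α) * fall α j
  fall-succ α zero    = base (+ 1 + α)
    where
    base : ∀ a → + 1 * (a - + 0) ≡ a * + 1
    base = solve-∀
  fall-succ α (suc j) = trans (cong (_* ((+ 1 + α) - (+ 1 + + j))) (fall-succ α j)) (step α (fall α j) (+ j))
    where
    step : ∀ a F J → ((+ 1 + a) * F) * ((+ 1 + a) - (+ 1 + J)) ≡ (+ 1 + a) * (F * (a - J))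
    step = solve-∀
  collect : ∀ K F S → (+ 1 + K) * F - F * (K - S) ≡ (+ 1 + S) * F
  collect = solve-∀

fall-zero : ∀ s → fall (+ 0) (suc s) ≡ + 0
fall-zero zero    = refl
fall-zero (suc s) = trans (cong (_* (+ 0 - + suc s)) (fall-zero s)) (ℤP.*-zeroˡ (+ 0 - + suc s))

Δ₀-fall : ∀ s i → Δ₀ i (λ k → fall (+ k) s) ≡ shift^ s (factorialUnit s) i
Δ₀-fall zero    zero    = refl
Δ₀-fall (suc s) zero    = fall-zero s
Δ₀-fall zero    (suc i) = Δ₀-zero i (λ k → refl)
Δ₀-fall (suc s) (suc i) = begin
  Δ₀ i (Δ (λ k → fall (+ k) (suc s)))    ≡⟨ Δ₀-cong i (Δ-fall s) ⟩
  Δ₀ i (λ k → + suc s * fall (+ k) s)    ≡⟨ Δ₀-* i (+ suc s) _ ⟩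
  + suc s * Δ₀ i (λ k → fall (+ k) s)    ≡⟨ cong (+ suc s *_) (Δ₀-fall s i) ⟩
  + suc s * shift^ s (factorialUnit s) i ≡⟨ sym (shift^-* s (+ suc s) (factorialUnit s) i) ⟩
  shift^ s (λ j → + suc s * factorialUnit s j) i ≡⟨ shift^-cong s unit-step i ⟩
  shift^ s (factorialUnit (suc s)) i     ∎
  where
  open ≡-Reasoning
  unit-step : (λ j → + suc s * factorialUnit s j) ≗ factorialUnit (suc s)
  unit-step zero    = sym (ℤP.pos-* (suc s) (s !))
  unit-step (suc j) = ℤP.*-zeroʳ (+ suc s)

binom : ℕ → ℕ → ℕ
binom zero    zero    = 1
binom zero    (suc j) = 0
binom (suc m) zero    = binom m zero
binom (suc m) (suc j) = binom m (suc j) ℕ.+ binom m j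

[1+x]^-δ₀ : ∀ m j → [1+x]^ m δ₀ j ≡ + binom m j
[1+x]^-δ₀ zero    zero    = refl
[1+x]^-δ₀ zero    (suc j) = refl
[1+x]^-δ₀ (suc m) zero    = trans (ℤP.+-identityʳ _) ([1+x]^-δ₀ m zero)
[1+x]^-δ₀ (suc m) (suc j) = cong₂ _+_ ([1+x]^-δ₀ m (suc j)) ([1+x]^-δ₀ m j)

binom-0 : ∀ m → binom m 0 ≡ 1
binom-0 zero    = refl
binom-0 (suc m) = binom-0 m

binom-1 : ∀ m → binom m 1 ≡ m
binom-1 zero    = refl
binom-1 (suc m) = trans (cong₂ ℕ._+_ (binom-1 m) (binom-0 m)) (ℕP.+-comm m 1)

binom-absorb : ∀ m j → suc j ℕ.* binom (suc m) (suc j) ≡ suc m ℕ.* binom m j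
binom-absorb zero    zero    = refl
binom-absorb zero    (suc j) = ℕP.*-zeroʳ (suc (suc j))
binom-absorb (suc m) zero    = begin
  1 ℕ.* (binom (suc m) 1 ℕ.+ binom m 0) ≡⟨ cong₂ (λ u v → 1 ℕ.* (u ℕ.+ v)) (binom-1 (suc m)) (binom-0 m) ⟩
  1 ℕ.* (suc m ℕ.+ 1)                   ≡⟨ normalise m ⟩
  suc (suc m) ℕ.* 1                     ≡⟨ cong (suc (suc m) ℕ.*_) (sym (binom-0 m)) ⟩
  suc (suc m) ℕ.* binom m 0             ∎
  where
  open ≡-Reasoning
  normalise : ∀ m → 1 ℕ.* (suc m ℕ.+ 1) ≡ suc (suc m) ℕ.* 1
  normalise = ℕSolver.solve-∀
binom-absorb (suc m) (suc j) = begin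
  suc (suc j) ℕ.* (binom (suc m) (suc (suc j)) ℕ.+ binom (suc m) (suc j))
    ≡⟨ ℕP.*-distribˡ-+ (suc (suc j)) (binom (suc m) (suc (suc j))) (binom (suc m) (suc j)) ⟩
  suc (suc j) ℕ.* binom (suc m) (suc (suc j)) ℕ.+ (binom (suc m) (suc j) ℕ.+ suc j ℕ.* binom (suc m) (suc j))
    ≡⟨ cong₂ (λ u v → u ℕ.+ (binom (suc m) (suc j) ℕ.+ v)) (binom-absorb m (suc j)) (binom-absorb m j) ⟩
  suc m ℕ.* binom m (suc j) ℕ.+ (binom (suc m) (suc j) ℕ.+ suc m ℕ.* binom m j)
    ≡⟨ collect (suc m) (binom m (suc j)) (binom m j) ⟩
  suc (suc m) ℕ.* (binom m (suc j) ℕ.+ binom m j) ∎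
  where
  open ≡-Reasoning
  collect : ∀ a x y → a ℕ.* x ℕ.+ ((x ℕ.+ y) ℕ.+ a ℕ.* y) ≡ suc a ℕ.* (x ℕ.+ y)
  collect = ℕSolver.solve-∀

prime-∣-binom : ∀ q → Prime (suc q) → ∀ j → j < q → suc q ℕD.∣ binom (suc q) (suc j)
prime-∣-binom q pr j j<q
  with euclidsLemma (suc j) (binom (suc q) (suc j)) pr
         (ℕD.divides (binom q j) (trans (binom-absorb q j) (ℕP.*-comm (suc q) _)))
... | inj₁ p∣j+1 = ⊥-elim (ℕP.<⇒≱ (s≤s j<q) (ℕD.∣⇒≤ p∣j+1))
... | inj₂ p∣C   = p∣C

weight : ℕ → ℕ → Seq
weight q k = shift^ k ([1+x]^ (q ∸ k) δ₀)

L : ℕ → Seq → Seq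
L q g i = Σ< (suc q) (λ k → g k * weight q k i)

coeff-lhs : ∀ q g → coeff (∑ₚ (suc q) (λ k → scale (g k) (wt (suc q) k))) ≗ L q g
coeff-lhs q g i = trans (coeff-∑ₚ (suc q) _ i) (Σ<-cong (suc q) λ k →
  trans (coeff-scale (g k) (wt (suc q) k) i) (cong (g k *_) (coeff-wt q k i)))

L-peel : ∀ q g i → L (suc q) g i ≡ g 0 * [1+x]^ (suc q) δ₀ i + shift (L q (E g)) i
L-peel q g i = trans (Σ<-first (suc q) _)
  (cong (_+_ (g 0 * [1+x]^ (suc q) δ₀ i)) (Σ<-shift (suc q) (E g) (weight q) i))

weight-succ : ∀ q k → k ≤ q → weight (suc q) k ≗ [1+x]^ 1 (weight q k)
weight-succ q k k≤q i = begin
  shift^ k ([1+x]^ (suc q ∸ k) δ₀) i               ≡⟨ cong (λ t → shift^ k ([1+x]^ t δ₀) i) (ℕP.+-∸-assoc 1 k≤q) ⟩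
  shift^ k ([1+x]^ 1 ([1+x]^ (q ∸ k) δ₀)) i        ≡⟨ sym ([1+x]^-shift^ 1 k ([1+x]^ (q ∸ k) δ₀) i) ⟩
  [1+x]^ 1 (weight q k) i                          ∎
  where open ≡-Reasoning

L-grow : ∀ q g i → L (suc q) g i ≡ [1+x]^ 1 (L q g) i + g (suc q) * shift^ (suc q) δ₀ i
L-grow q g i =
  cong₂ _+_ lower-terms (cong (λ t → g (suc q) * shift^ (suc q) ([1+x]^ t δ₀) i) (ℕP.n∸n≡0 q))
  where
  open ≡-Reasoning
  lower-terms : Σ< (suc q) (λ k → g k * weight (suc q) k i) ≡ [1+x]^ 1 (L q g) i
  lower-terms = begin
    Σ< (suc q) (λ k → g k * weight (suc q) k i)
      ≡⟨ Σ<-cong< (suc q) (λ k k<q+1 → cong (g k *_) (weight-succ q k (ℕP.≤-pred k<q+1) i)) ⟩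
    Σ< (suc q) (λ k → g k * (weight q k i + shift (weight q k) i))
      ≡⟨ Σ<-cong (suc q) (λ k → ℤP.*-distribˡ-+ (g k) _ _) ⟩
    Σ< (suc q) (λ k → g k * weight q k i + g k * shift (weight q k) i)
      ≡⟨ Σ<-+ (suc q) _ _ ⟩
    L q g i + Σ< (suc q) (λ k → g k * shift (weight q k) i)
      ≡⟨ cong (_+_ (L q g i)) (Σ<-shift (suc q) g (weight q) i) ⟩
    L q g i + shift (L q g) i ∎

L-Δ : ∀ q g i → L q (Δ g) i ≡ L q (E g) i - L q g i
L-Δ q g i = trans (Σ<-cong (suc q) (λ k → distrib (g (suc k)) (g k) (weight q k i))) (Σ<-- (suc q) _ _)
  where
  distrib : ∀ a b w → (a - b) * w ≡ a * w - b * w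
  distrib = solve-∀

L-at-0 : ∀ q g → L q g 0 ≡ g 0
L-at-0 q g = begin
  L q g 0
    ≡⟨ Σ<-first q _ ⟩
  g 0 * [1+x]^ q δ₀ 0 + Σ< q (λ k → g (suc k) * + 0)
    ≡⟨ cong₂ _+_ (cong (g 0 *_) (trans ([1+x]^-δ₀ q 0) (cong +_ (binom-0 q))))
                 (Σ<-zero q (λ k _ → ℤP.*-zeroʳ (g (suc k)))) ⟩
  g 0 * + 1 + + 0
    ≡⟨ trans (ℤP.+-identityʳ _) (ℤP.*-identityʳ (g 0)) ⟩
  g 0 ∎
  where open ≡-Reasoning

L-Δ-identity : ∀ q g i → i < q → L q (Δ g) i ≡ L q g (suc i) - g 0 * [1+x]^ (suc q) δ₀ (suc i)
L-Δ-identity q g i i<q = begin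
  L q (Δ g) i              ≡⟨ L-Δ q g i ⟩
  L q (E g) i - L q g i    ≡⟨ rearrange C (L q (E g) i) (L q g (suc i)) (L q g i) both-expansions ⟩
  L q g (suc i) - C        ∎
  where
  open ≡-Reasoning
  C = g 0 * [1+x]^ (suc q) δ₀ (suc i)
  rearrange : ∀ a b c d → a + b ≡ c + d → b - d ≡ c - a
  rearrange a b c d e = begin
    b - d               ≡⟨ add-sub a b d ⟩
    ((a + b) - a) - d   ≡⟨ cong (λ z → (z - a) - d) e ⟩
    ((c + d) - a) - d   ≡⟨ cancel a c d ⟩
    c - a               ∎
    where
    add-sub : ∀ a b d → b - d ≡ ((a + b) - a) - d
    add-sub = solve-∀
    cancel : ∀ a c d → ((c + d) - a) - d ≡ c - a
    cancel = solve-∀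
  -- L_{q+1}(g) at degree i+1, expanded by L-peel and by L-grow.
  both-expansions : C + L q (E g) i ≡ L q g (suc i) + L q g i
  both-expansions = begin
    C + L q (E g) i
      ≡⟨ sym (L-peel q g (suc i)) ⟩
    L (suc q) g (suc i)
      ≡⟨ L-grow q g (suc i) ⟩
    [1+x]^ 1 (L q g) (suc i) + g (suc q) * shift^ (suc q) δ₀ (suc i)
      ≡⟨ cong (λ z → [1+x]^ 1 (L q g) (suc i) + g (suc q) * z) (shift^-below (suc q) δ₀ (suc i) (s≤s i<q)) ⟩
    [1+x]^ 1 (L q g) (suc i) + g (suc q) * + 0
      ≡⟨ trans (cong (_+_ ([1+x]^ 1 (L q g) (suc i))) (ℤP.*-zeroʳ (g (suc q)))) (ℤP.+-identityʳ _) ⟩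
    L q g (suc i) + L q g i ∎

L-congruence : ∀ q → Prime (suc q) → ∀ i → i ≤ q → ∀ g → + suc q ∣ L q g i - Δ₀ i g
L-congruence q pr zero    _    g = subst (+ suc q ∣_) (sym vanishes) ∣-zero
  where
  vanishes : L q g 0 - g 0 ≡ + 0
  vanishes = trans (cong (_- g 0) (L-at-0 q g)) (ℤP.+-inverseʳ (g 0))
L-congruence q pr (suc i) i<q g =
  subst (+ suc q ∣_) (sym split)
        (∣m∣n⇒∣m+n (L-congruence q pr i (ℕP.<⇒≤ i<q) (Δ g))
                   (∣n⇒∣m*n (g 0) (subst (+ suc q ∣_) (sym ([1+x]^-δ₀ (suc q) (suc i)))
                                         (∣ᵤ⇒∣ (prime-∣-binom q pr i i<q)))))
  where
  open ≡-Reasoning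
  C = g 0 * [1+x]^ (suc q) δ₀ (suc i)
  split : L q g (suc i) - Δ₀ i (Δ g) ≡ (L q (Δ g) i - Δ₀ i (Δ g)) + C
  split = begin
    L q g (suc i) - Δ₀ i (Δ g)
      ≡⟨ regroup (L q g (suc i)) C (Δ₀ i (Δ g)) ⟩
    ((L q g (suc i) - C) - Δ₀ i (Δ g)) + C
      ≡⟨ cong (λ z → (z - Δ₀ i (Δ g)) + C) (sym (L-Δ-identity q g i i<q)) ⟩
    (L q (Δ g) i - Δ₀ i (Δ g)) + C ∎
    where
    regroup : ∀ y z w → y - w ≡ ((y - z) - w) + z
    regroup = solve-∀

DivisibleFrom : ℕ → ℕ → Seq → Set
DivisibleFrom p m F = ∀ j → m ≤ j → + p ∣ F j

divFrom-mono : ∀ {p m m' F} → m ≤ m' → DivisibleFrom p m F → DivisibleFrom p m' F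
divFrom-mono m≤m' d j m'≤j = d j (ℕP.≤-trans m≤m' m'≤j)

divFrom-+ : ∀ {p m F G} → DivisibleFrom p m F → DivisibleFrom p m G → DivisibleFrom p m (λ j → F j + G j)
divFrom-+ dF dG j m≤j = ∣m∣n⇒∣m+n (dF j m≤j) (dG j m≤j)

divFrom-* : ∀ {p m F} c → DivisibleFrom p m F → DivisibleFrom p m (λ j → c * F j)
divFrom-* c d j m≤j = ∣n⇒∣m*n c (d j m≤j)

divFrom-Σ< : ∀ {p m} n (h : ℕ → Seq) → (∀ k → k < n → DivisibleFrom p m (h k)) →
  DivisibleFrom p m (λ j → Σ< n (λ k → h k j))
divFrom-Σ< zero    h d j m≤j = ∣-zero
divFrom-Σ< (suc n) h d j m≤j =
  ∣m∣n⇒∣m+n (divFrom-Σ< n h (λ k k<n → d k (ℕP.m<n⇒m<1+n k<n)) j m≤j) (d n ℕP.≤-refl j m≤j)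

divFrom-shift : ∀ {p} m {F} → DivisibleFrom p (m ∸ 1) F → DivisibleFrom p m (shift F)
divFrom-shift m d zero    _   = ∣-zero
divFrom-shift m d (suc j) m≤j = d j (ℕP.∸-monoˡ-≤ 1 m≤j)

divFrom-shift^ : ∀ {p} k m {F} → DivisibleFrom p (m ∸ k) F → DivisibleFrom p m (shift^ k F)
divFrom-shift^ zero    m d = d
divFrom-shift^ (suc k) m d =
  divFrom-shift m (divFrom-shift^ k (m ∸ 1) (divFrom-mono m∸[1+k]≤m∸1∸k d))
  where
  m∸[1+k]≤m∸1∸k : m ∸ suc k ≤ m ∸ 1 ∸ k
  m∸[1+k]≤m∸1∸k = ℕP.≤-reflexive (sym (ℕP.∸-+-assoc m 1 k))

divFrom-[1+x]^ : ∀ {p} t m {F} → DivisibleFrom p (m ∸ t) F → DivisibleFrom p m ([1+x]^ t F)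
divFrom-[1+x]^ zero    m d = d
divFrom-[1+x]^ (suc t) m d =
  divFrom-+ (divFrom-[1+x]^ t m (divFrom-mono (ℕP.∸-monoʳ-≤ m (ℕP.n≤1+n t)) d))
            (divFrom-shift m (divFrom-[1+x]^ t (m ∸ 1) (divFrom-mono m∸[1+t]≤m∸1∸t d)))
  where
  m∸[1+t]≤m∸1∸t : m ∸ suc t ≤ m ∸ 1 ∸ t
  m∸[1+t]≤m∸1∸t = ℕP.≤-reflexive (sym (ℕP.∸-+-assoc m 1 t))

divFrom-δ₀ : ∀ {p} → DivisibleFrom p 1 δ₀
divFrom-δ₀ (suc j) _ = ∣-zero

∣-factorial : ∀ q a j → suc q ≤ j → + suc q ∣ + (a ℕ.* j !)
∣-factorial q a j q<j = ∣ᵤ⇒∣ (ℕD.∣-trans p∣j! (ℕD.n∣m*n a))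
  where
  p∣j! : suc q ℕD.∣ j !
  p∣j! = ℕD.∣-trans (ℕD.m∣m*n (q !)) (ℕD.m≤n⇒m!∣n! q<j)

-- In degrees ≥ p = q + 1 the left side is divisible by p (its weights have degree ≤ q).
L-high : ∀ q g → DivisibleFrom (suc q) (suc q) (L q g)
L-high q g = divFrom-Σ< (suc q) (λ k i → g k * weight q k i) λ k k<q+1 →
  divFrom-* (g k) (divFrom-shift^ k (suc q) (divFrom-[1+x]^ (q ∸ k) (suc q ∸ k)
    (divFrom-mono (ℕP.≤-reflexive (sym (gap k (ℕP.≤-pred k<q+1)))) divFrom-δ₀)))
  where
  gap : ∀ k → k ≤ q → suc q ∸ k ∸ (q ∸ k) ≡ 1
  gap k k≤q = trans (cong (_∸ (q ∸ k)) (ℕP.+-∸-assoc 1 k≤q)) (ℕP.m+n∸n≡m 1 (q ∸ k))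

coeff-fubini : ∀ m → coeff (fubini m) ≗ λ i → + (S2 m i ℕ.* i !)
coeff-fubini m = coeff-monomials (suc m) (λ i → + (S2 m i ℕ.* i !))
  (λ i m<i → cong (λ z → + (z ℕ.* i !)) (S2-above m i m<i))
  where
  S2-above : ∀ m i → m < i → S2 m i ≡ 0
  S2-above zero    (suc i) _ = refl
  S2-above (suc m) (suc i) (s≤s m<i)
    rewrite S2-above m (suc i) (ℕP.m<n⇒m<1+n m<i) | S2-above m i m<i
    = trans (ℕP.+-identityʳ _) (ℕP.*-zeroʳ (suc i))

-- coeff (∑_j c_j F_{m+j}) i = Δ₀ i (k ↦ k^m f(k)) for f = ∑_j c_j u^j;
-- the case m = 0 identifies the coefficients of f(F_x).
coeff-umbral : ∀ f m i → coeff (umbralFrom f m) i ≡ Δ₀ i (λ k → (+ k) ^ m * eval f (+ k))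
coeff-umbral []       m i = sym (Δ₀-zero i (λ k → ℤP.*-zeroʳ ((+ k) ^ m)))
coeff-umbral (c ∷ cs) m i = begin
  coeff (scale c (fubini m) ⊕ umbralFrom cs (suc m)) i
    ≡⟨ coeff-⊕ (scale c (fubini m)) _ i ⟩
  coeff (scale c (fubini m)) i + coeff (umbralFrom cs (suc m)) i
    ≡⟨ cong₂ _+_ (trans (coeff-scale c (fubini m) i) (cong (c *_) (trans (coeff-fubini m i) (sym (Δ₀-pow m i)))))
                 (coeff-umbral cs (suc m) i) ⟩
  c * Δ₀ i (λ k → (+ k) ^ m) + Δ₀ i (λ k → (+ k) ^ suc m * eval cs (+ k))
    ≡⟨ cong (_+ Δ₀ i (λ k → (+ k) ^ suc m * eval cs (+ k))) (sym (Δ₀-* i c _)) ⟩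
  Δ₀ i (λ k → c * (+ k) ^ m) + Δ₀ i (λ k → (+ k) ^ suc m * eval cs (+ k))
    ≡⟨ sym (Δ₀-+ i _ _) ⟩
  Δ₀ i (λ k → c * (+ k) ^ m + (+ k) ^ suc m * eval cs (+ k))
    ≡⟨ sym (Δ₀-cong i (λ k → horner ((+ k) ^ m) (+ k) c (eval cs (+ k)))) ⟩
  Δ₀ i (λ k → (+ k) ^ m * eval (c ∷ cs) (+ k)) ∎
  where
  open ≡-Reasoning
  horner : ∀ P x c e → P * (c + x * e) ≡ c * P + (x * P) * e
  horner = solve-∀

umbral-high : ∀ q f m → DivisibleFrom (suc q) (suc q) (coeff (umbralFrom f m))
umbral-high q []       m j _   = ∣-zero
umbral-high q (c ∷ cs) m j q<j = subst (+ suc q ∣_) (sym (coeff-⊕ (scale c (fubini m)) _ j))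
  (∣m∣n⇒∣m+n (subst (+ suc q ∣_) (sym (trans (coeff-scale c (fubini m) j) (cong (c *_) (coeff-fubini m j))))
                   (∣n⇒∣m*n c (∣-factorial q (S2 m j) j q<j)))
             (umbral-high q cs (suc m) j q<j))

-- The operator G ↦ (i ↦ i·(G(i-1) + G(i)) + c·G(i)).  It governs both the
-- differences of k ↦ (c + k)·h(k) and the recurrence of x^s F_n(x;r,s) in n.
fubiniStep : ℤ → Seq → Seq
fubiniStep c G i = + i * (shift G i + G i) + c * G i

Δ₀-affine* : ∀ c h i → Δ₀ i (λ k → (c + + k) * h k) ≡ fubiniStep c (λ j → Δ₀ j h) i
Δ₀-affine* c h i = begin
  Δ₀ i (λ k → (c + + k) * h k)                   ≡⟨ Δ₀-cong i (λ k → split c (+ k) (h k)) ⟩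
  Δ₀ i (λ k → + k * h k + c * h k)               ≡⟨ Δ₀-+ i (λ k → + k * h k) (λ k → c * h k) ⟩
  Δ₀ i (λ k → + k * h k) + Δ₀ i (λ k → c * h k)  ≡⟨ cong₂ _+_ (Δ₀-id*′ i h) (Δ₀-* i c h) ⟩
  fubiniStep c (λ j → Δ₀ j h) i                  ∎
  where
  open ≡-Reasoning
  split : ∀ c K H → (c + K) * H ≡ K * H + c * H
  split = solve-∀

module RFubini (r s : ℕ) where

  rsCoeff : ℕ → Seq
  rsCoeff n j = + (rS r n j ℕ.* (j ℕ.+ s) !)

  coeff-fubiniRS : ∀ n → coeff (fubiniRS n r s) ≗ rsCoeff n
  coeff-fubiniRS n = coeff-monomials (suc n) (rsCoeff n)
    (λ i n<i → cong (λ z → + (z ℕ.* (i ℕ.+ s) !)) (rS-above n i n<i))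
    where
    rS-above : ∀ n k → n < k → rS r n k ≡ 0
    rS-above zero    (suc k) _ = refl
    rS-above (suc n) (suc k) (s≤s n<k)
      rewrite rS-above n (suc k) (ℕP.m<n⇒m<1+n n<k) | rS-above n k n<k
      = trans (ℕP.+-identityʳ _) (ℕP.*-zeroʳ (suc k ℕ.+ r))

  -- The coefficient of x^j carries the factor (j+s)!, so it is divisible by
  -- p = q + 1 as soon as j + s ≥ p.
  rsCoeff-high : ∀ q n → DivisibleFrom (suc q) (suc q ∸ s) (rsCoeff n)
  rsCoeff-high q n j bound = ∣-factorial q (rS r n j) (j ℕ.+ s) (begin
    suc q            ≤⟨ ℕP.m≤n+m∸n (suc q) s ⟩
    s ℕ.+ (suc q ∸ s) ≤⟨ ℕP.+-monoʳ-≤ s bound ⟩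
    s ℕ.+ j          ≡⟨ ℕP.+-comm s j ⟩
    j ℕ.+ s          ∎)
    where open ℕP.≤-Reasoning

  c₀ : ℤ
  c₀ = + r - + s

  rsCoeff-rec : ∀ n j → rsCoeff (suc n) j ≡ + (s ℕ.+ j) * (shift (rsCoeff n) j + rsCoeff n j) + c₀ * rsCoeff n j
  rsCoeff-rec n j = isolate (rsCoeff (suc n) j) (rsCoeff n j) (+ (s ℕ.+ j) * (shift (rsCoeff n) j + rsCoeff n j)) lifted
    where
    open ≡-Reasoning
    cur  = rS r n j ℕ.* (j ℕ.+ s) !
    prev : ℕ → ℕ
    prev zero    = 0
    prev (suc j) = rS r n j ℕ.* (j ℕ.+ s) !

    shift-prev : ∀ j → shift (rsCoeff n) j ≡ + prev j
    shift-prev zero    = refl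
    shift-prev (suc j) = refl

    recurrence : ∀ j → rS r (suc n) j ℕ.* (j ℕ.+ s) ! ℕ.+ s ℕ.* (rS r n j ℕ.* (j ℕ.+ s) !)
                     ≡ (s ℕ.+ j) ℕ.* (prev j ℕ.+ rS r n j ℕ.* (j ℕ.+ s) !)
                       ℕ.+ r ℕ.* (rS r n j ℕ.* (j ℕ.+ s) !)
    recurrence zero    = at-0 r s (rS r n 0) (s !)
      where
      at-0 : ∀ r s A F → (r ℕ.* A) ℕ.* F ℕ.+ s ℕ.* (A ℕ.* F)
                       ≡ (s ℕ.+ 0) ℕ.* (0 ℕ.+ A ℕ.* F) ℕ.+ r ℕ.* (A ℕ.* F)
      at-0 = ℕSolver.solve-∀
    recurrence (suc j) = at-suc j s r (rS r n (suc j)) (rS r n j) ((j ℕ.+ s) !)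
      where
      at-suc : ∀ j s r A B G →
          ((suc j ℕ.+ r) ℕ.* A ℕ.+ B) ℕ.* (suc (j ℕ.+ s) ℕ.* G) ℕ.+ s ℕ.* (A ℕ.* (suc (j ℕ.+ s) ℕ.* G))
        ≡ (s ℕ.+ suc j) ℕ.* (B ℕ.* G ℕ.+ A ℕ.* (suc (j ℕ.+ s) ℕ.* G))
          ℕ.+ r ℕ.* (A ℕ.* (suc (j ℕ.+ s) ℕ.* G))
      at-suc = ℕSolver.solve-∀

    lifted : rsCoeff (suc n) j + + s * rsCoeff n j
           ≡ + (s ℕ.+ j) * (shift (rsCoeff n) j + rsCoeff n j) + + r * rsCoeff n j
    lifted = begin
      + (rS r (suc n) j ℕ.* (j ℕ.+ s) !) + + s * + cur
        ≡⟨ cong (_+_ (+ (rS r (suc n) j ℕ.* (j ℕ.+ s) !))) (sym (ℤP.pos-* s cur)) ⟩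
      + (rS r (suc n) j ℕ.* (j ℕ.+ s) !) + + (s ℕ.* cur)
        ≡⟨ sym (ℤP.pos-+ _ (s ℕ.* cur)) ⟩
      + (rS r (suc n) j ℕ.* (j ℕ.+ s) ! ℕ.+ s ℕ.* cur)
        ≡⟨ cong +_ (recurrence j) ⟩
      + ((s ℕ.+ j) ℕ.* (prev j ℕ.+ cur) ℕ.+ r ℕ.* cur)
        ≡⟨ ℤP.pos-+ ((s ℕ.+ j) ℕ.* (prev j ℕ.+ cur)) (r ℕ.* cur) ⟩
      + ((s ℕ.+ j) ℕ.* (prev j ℕ.+ cur)) + + (r ℕ.* cur)
        ≡⟨ cong₂ _+_ (trans (ℤP.pos-* (s ℕ.+ j) _) (cong (+ (s ℕ.+ j) *_) (ℤP.pos-+ (prev j) cur)))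
                     (ℤP.pos-* r cur) ⟩
      + (s ℕ.+ j) * (+ prev j + + cur) + + r * + cur
        ≡⟨ cong (λ z → + (s ℕ.+ j) * (z + + cur) + + r * + cur) (sym (shift-prev j)) ⟩
      + (s ℕ.+ j) * (shift (rsCoeff n) j + rsCoeff n j) + + r * rsCoeff n j ∎

    isolate : ∀ L C M → L + + s * C ≡ M + + r * C → L ≡ M + c₀ * C
    isolate L C M e = begin
      L                           ≡⟨ add-sub L (+ s * C) ⟩
      (L + + s * C) - + s * C     ≡⟨ cong (_- + s * C) e ⟩
      (M + + r * C) - + s * C     ≡⟨ collect M (+ r) (+ s) C ⟩
      M + c₀ * C                  ∎
      where
      add-sub : ∀ a b → a ≡ (a + b) - b
      add-sub = solve-∀
      collect : ∀ M R S C → (M + R * C) - S * C ≡ M + (R - S) * C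
      collect = solve-∀

  shifted-rec : ∀ n → shift^ s (rsCoeff (suc n)) ≗ fubiniStep c₀ (shift^ s (rsCoeff n))
  shifted-rec n i with ℕP.≤-<-connex s i
  ... | inj₂ i<s = begin
    shift^ s (rsCoeff (suc n)) i                       ≡⟨ shift^-below s _ i i<s ⟩
    + 0                                                ≡⟨ sym (vanish (+ i) c₀) ⟩
    + i * (+ 0 + + 0) + c₀ * + 0                       ≡⟨ cong₂ (λ u v → + i * (u + v) + c₀ * v)
                                                                (sym (shift^-below (suc s) (rsCoeff n) i (ℕP.m<n⇒m<1+n i<s)))
                                                                (sym (shift^-below s (rsCoeff n) i i<s)) ⟩
    fubiniStep c₀ (shift^ s (rsCoeff n)) i             ∎
    where
    open ≡-Reasoning
    vanish : ∀ I C → I * (+ 0 + + 0) + C * + 0 ≡ + 0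
    vanish = solve-∀
  ... | inj₁ s≤i = subst (λ i → shift^ s (rsCoeff (suc n)) i ≡ fubiniStep c₀ (shift^ s (rsCoeff n)) i)
                         (ℕP.m+[n∸m]≡n s≤i) (at (i ∸ s))
    where
    open ≡-Reasoning
    F = rsCoeff n
    at : ∀ j → shift^ s (rsCoeff (suc n)) (s ℕ.+ j) ≡ fubiniStep c₀ (shift^ s F) (s ℕ.+ j)
    at j = begin
      shift^ s (rsCoeff (suc n)) (s ℕ.+ j)                         ≡⟨ shift^-at s (rsCoeff (suc n)) j ⟩
      rsCoeff (suc n) j                                            ≡⟨ rsCoeff-rec n j ⟩
      + (s ℕ.+ j) * (shift F j + F j) + c₀ * F j                   ≡⟨ cong₂ (λ u v → + (s ℕ.+ j) * (u + v) + c₀ * v)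
                                                                          (sym shift-at) (sym (shift^-at s F j)) ⟩
      fubiniStep c₀ (shift^ s F) (s ℕ.+ j)                         ∎
      where
      shift-at : shift (shift^ s F) (s ℕ.+ j) ≡ shift F j
      shift-at = trans (sym (shift^-shift s F (s ℕ.+ j))) (shift^-at s (shift F) j)

  term₁ : ℕ → Seq
  term₁ n k = ((c₀ + + k) ^ n) * fall (+ k) s

  term₂ : ℕ → Seq
  term₂ n k = ((+ r + + k) ^ n) * fall (+ s + + k) s

  -- Both Δ₀ (term₁ n) and x^s·F_n(x;r,s) start at s!·x^s and obey fubiniStep c₀.
  Δ₀-term₁ : ∀ n i → Δ₀ i (term₁ n) ≡ shift^ s (rsCoeff n) i
  Δ₀-term₁ zero    i = begin
    Δ₀ i (term₁ 0)                  ≡⟨ Δ₀-cong i (λ k → ℤP.*-identityˡ (fall (+ k) s)) ⟩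
    Δ₀ i (λ k → fall (+ k) s)       ≡⟨ Δ₀-fall s i ⟩
    shift^ s (factorialUnit s) i    ≡⟨ shift^-cong s initial i ⟩
    shift^ s (rsCoeff 0) i          ∎
    where
    open ≡-Reasoning
    initial : factorialUnit s ≗ rsCoeff 0
    initial zero    = cong +_ (sym (ℕP.*-identityˡ (s !)))
    initial (suc j) = refl
  Δ₀-term₁ (suc n) i = begin
    Δ₀ i (term₁ (suc n))                                ≡⟨ Δ₀-cong i (λ k → ℤP.*-assoc (c₀ + + k) _ _) ⟩
    Δ₀ i (λ k → (c₀ + + k) * term₁ n k)                 ≡⟨ Δ₀-affine* c₀ (term₁ n) i ⟩
    fubiniStep c₀ (λ j → Δ₀ j (term₁ n)) i              ≡⟨ cong₂ (λ u v → + i * (u + v) + c₀ * v)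
                                                                 (shift-cong (Δ₀-term₁ n) i) (Δ₀-term₁ n i) ⟩
    fubiniStep c₀ (shift^ s (rsCoeff n)) i              ≡⟨ sym (shifted-rec n i) ⟩
    shift^ s (rsCoeff (suc n)) i                        ∎
    where open ≡-Reasoning

  -- Translating term₁ by t trades t powers of x for t factors (1 + x), since E = 1 + Δ.
  Δ₀-translate : ∀ n t d → d ℕ.+ t ≡ s → ∀ i →
    Δ₀ i (λ k → term₁ n (t ℕ.+ k)) ≡ shift^ d ([1+x]^ t (rsCoeff n)) i
  Δ₀-translate n zero    d d+0≡s i =
    trans (Δ₀-term₁ n i) (cong (λ e → shift^ e (rsCoeff n) i) (sym (trans (sym (ℕP.+-identityʳ d)) d+0≡s)))
  Δ₀-translate n (suc t) d d+t+1≡s i = begin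
    Δ₀ i (λ k → term₁ n (suc (t ℕ.+ k)))       ≡⟨ Δ₀-cong i (λ k → cong (term₁ n) (sym (ℕP.+-suc t k))) ⟩
    Δ₀ i (E h)                                 ≡⟨ Δ₀-E i h ⟩
    Δ₀ i h + Δ₀ (suc i) h                      ≡⟨ cong₂ _+_ (IH i) (IH (suc i)) ⟩
    shift^ (suc d) B i + shift^ d B i          ≡⟨ ℤP.+-comm (shift^ (suc d) B i) (shift^ d B i) ⟩
    shift^ d B i + shift (shift^ d B) i        ≡⟨ cong (_+_ (shift^ d B i)) (sym (shift^-shift d B i)) ⟩
    shift^ d B i + shift^ d (shift B) i        ≡⟨ sym (shift^-+ d B (shift B) i) ⟩
    shift^ d ([1+x]^ (suc t) (rsCoeff n)) i    ∎
    where
    open ≡-Reasoning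
    h = λ k → term₁ n (t ℕ.+ k)
    B = [1+x]^ t (rsCoeff n)
    IH = Δ₀-translate n t (suc d) (trans (sym (ℕP.+-suc d t)) d+t+1≡s)

  Δ₀-term₂ : ∀ n i → Δ₀ i (term₂ n) ≡ [1+x]^ s (rsCoeff n) i
  Δ₀-term₂ n i = trans (Δ₀-cong i as-translate) (Δ₀-translate n s 0 refl i)
    where
    cancel : ∀ R S K → R - S + (S + K) ≡ R + K
    cancel = solve-∀
    as-translate : term₂ n ≗ λ k → term₁ n (s ℕ.+ k)
    as-translate k = cong (λ z → (z ^ n) * fall (+ s + + k) s) (sym (cancel (+ r) (+ s) (+ k)))

  coeff-side₁ : ∀ n → coeff ((X ^ₚ s) ⊗ fubiniRS n r s) ≗ shift^ s (rsCoeff n)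
  coeff-side₁ n i = trans (coeff-X^⊗ s (fubiniRS n r s) i) (shift^-cong s (coeff-fubiniRS n) i)

  coeff-side₂ : ∀ n → coeff (((X ⊕ const (+ 1)) ^ₚ s) ⊗ fubiniRS n r s) ≗ [1+x]^ s (rsCoeff n)
  coeff-side₂ n i = trans (coeff-X1^⊗ s (fubiniRS n r s) i) ([1+x]^-cong s (coeff-fubiniRS n) i)

congruence-criterion : ∀ q → Prime (suc q) → ∀ g R →
  (∀ i → i ≤ q → coeff R i ≡ Δ₀ i g) → DivisibleFrom (suc q) (suc q) (coeff R) →
  ∑ₚ (suc q) (λ k → scale (g k) (wt (suc q) k)) ≡ₚ R [mod suc q ]
congruence-criterion q pr g R low high i with ℕP.≤-<-connex i q
... | inj₁ i≤q = ∣⇒∣ᵤ (subst (+ suc q ∣_) (sym (cong₂ _-_ (coeff-lhs q g i) (low i i≤q)))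
                            (L-congruence q pr i i≤q g))
... | inj₂ q<i = ∣⇒∣ᵤ (∣m∣n⇒∣m-n (subst (+ suc q ∣_) (sym (coeff-lhs q g i)) (L-high q g i q<i))
                                (high i q<i))

proposition10 : (n r s p : ℕ) → Prime p → (f : Poly) →
    (∑ₚ p (λ k → scale (eval f (+ k)) (wt p k)) ≡ₚ umbral f [mod p ])
    × (∑ₚ p (λ k → scale (((+ r - + s + + k) ^ n) Data.Integer.* fall (+ k) s) (wt p k))
        ≡ₚ (X ^ₚ s) ⊗ fubiniRS n r s [mod p ])
    × (∑ₚ p (λ k → scale (((+ r + + k) ^ n) Data.Integer.* fall (+ s + + k) s) (wt p k))
        ≡ₚ ((X ⊕ const (+ 1)) ^ₚ s) ⊗ fubiniRS n r s [mod p ])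
proposition10 n r s zero    (prime {{()}} _) f
proposition10 n r s (suc q) pr f =
    congruence-criterion q pr (λ k → eval f (+ k)) (umbral f)
      (λ i _ → trans (coeff-umbral f 0 i) (Δ₀-cong i (λ k → ℤP.*-identityˡ (eval f (+ k)))))
      (umbral-high q f 0)
  , congruence-criterion q pr (term₁ n) ((X ^ₚ s) ⊗ fubiniRS n r s)
      (λ i _ → trans (coeff-side₁ n i) (sym (Δ₀-term₁ n i)))
      (λ i q<i → subst (+ suc q ∣_) (sym (coeff-side₁ n i))
                   (divFrom-shift^ s (suc q) (rsCoeff-high q n) i q<i))
  , congruence-criterion q pr (term₂ n) (((X ⊕ const (+ 1)) ^ₚ s) ⊗ fubiniRS n r s)
      (λ i _ → trans (coeff-side₂ n i) (sym (Δ₀-term₂ n i)))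
      (λ i q<i → subst (+ suc q ∣_) (sym (coeff-side₂ n i))
                   (divFrom-[1+x]^ s (suc q) (rsCoeff-high q n) i q<i))
  where open RFubini r s
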